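{- For all integers $k\ge 2$ and $n\ge 1$, $$\mathrm{HB}_k(n)\le n-\sqrt{2.43(n-1)}.$$
   Context: A partial word over an alphabet $A$ is a finite word over $A\cup\{\diamondsuit\}$, $\diamondsuit\notin A$ a hole symbol. Two partial words of equal length are compatible if they agree at every position where both have letters (not holes). A partial word is unbordered if no nonempty proper prefix is compatible with the proper suffix of the same length. $\mathrm{HB}_k(n)$ is the maximum number of holes an unbordered partial word of length $n$ over an alphabet of size $k$ can have. -}

module Defs where

open import Data.Nat using (ℕ; zero; suc; _+_; _∸_; _<_; _≤_)
open import Data.Fin using (Fin)
open import Data.Maybe using (Maybe; just; nothing)
open import Data.List using (List; length; take; drop; filter)
open import Data.List.Relation.Binary.Pointwise using (Pointwise)
open import Data.Unit using (⊤)
open import Data.Product using (_×_)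
open import Relation.Nullary using (¬_)
open import Relation.Binary.PropositionalEquality using (_≡_)
open import Data.Maybe.Properties using ()
open import Relation.Unary using (Decidable)
open import Relation.Nullary using (yes; no)
open import Data.Empty using (⊥)

-- A partial word over the alphabet Fin k: a list of letters, with
-- 'nothing' playing the role of the hole symbol ◇.
PartialWord : ℕ → Set
PartialWord k = List (Maybe (Fin k))

CompatSym : ∀ {k} → Maybe (Fin k) → Maybe (Fin k) → Set
CompatSym nothing  _        = ⊤
CompatSym (just _) nothing  = ⊤
CompatSym (just a) (just b) = a ≡ b

Compatible : ∀ {k} → PartialWord k → PartialWord k → Set
Compatible u v = Pointwise CompatSym u v

Unbordered : ∀ {k} → PartialWord k → Set
Unbordered {k} w =
  (m : ℕ) → 1 ≤ m → m < length w →
  ¬ Compatible (take m w) (drop (length w ∸ m) w)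

isHole : ∀ {k} → Decidable (λ (x : Maybe (Fin k)) → x ≡ nothing)
isHole nothing  = yes _≡_.refl
isHole (just _) = no (λ ())

holes : ∀ {k} → PartialWord k → ℕ
holes w = length (filter isHole w)

{-# OPTIONS --safe #-}
module Submission where

-- An unbordered partial word of length n has, for every shift 1 ≤ d < n, two letters at
-- distance d (otherwise its prefix and suffix of length n − d would be compatible), so the
-- letter positions form a difference basis of [0, n). Let x be their indicator, ℓ = Σ x the
-- number of letters, and c the autocorrelation of a periodic integer sequence v. Expanding
-- Σ_m (Σ_i x_i v_{m+i})² ≥ 0 and using c_e ≤ c₀ on the covered differences gives
--   2 Σ_{d=1}^{n−1} (c₀ − c_d) ≤ ℓ² c₀.
-- When v repeats each entry of a short profile B times, c is piecewise linear and the left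
-- side has a closed form. For n ≥ 392 the profile wave₂₄ with B = ⌊(n − 1)/17⌋ gives
-- 243 (n − 1) ≤ 100 ℓ² by a polynomial identity; shorter lengths are certified by evaluation,
-- with a profile and a block length chosen for each length.

open import Defs

module Sums where
  open import Data.Nat as ℕ using (ℕ; zero; suc)
  import Data.Nat.Properties as ℕ
  open import Data.Integer using (ℤ; +_; 0ℤ; 1ℤ; _+_; _*_; _-_; _≤_; nonNegative)
  import Data.Integer.Properties as ℤ
  open import Data.Integer.Tactic.RingSolver using (solve-∀)
  open import Function using (_∘_)
  open import Relation.Binary.PropositionalEquality

  ∑ : ℕ → (ℕ → ℤ) → ℤ
  ∑ zero    f = 0ℤ
  ∑ (suc n) f = f 0 + ∑ n (f ∘ suc)

  ∑-congᵇ : ∀ n {f g : ℕ → ℤ} → (∀ i → i ℕ.< n → f i ≡ g i) → ∑ n f ≡ ∑ n g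
  ∑-congᵇ zero    f≡g = refl
  ∑-congᵇ (suc n) f≡g = cong₂ _+_ (f≡g 0 (ℕ.s≤s ℕ.z≤n)) (∑-congᵇ n (λ i i<n → f≡g (suc i) (ℕ.s≤s i<n)))

  ∑-cong : ∀ n {f g : ℕ → ℤ} → (∀ i → f i ≡ g i) → ∑ n f ≡ ∑ n g
  ∑-cong n f≡g = ∑-congᵇ n (λ i _ → f≡g i)

  ∑-+ : ∀ n (f g : ℕ → ℤ) → ∑ n (λ i → f i + g i) ≡ ∑ n f + ∑ n g
  ∑-+ zero    f g = refl
  ∑-+ (suc n) f g = trans (cong (_+_ (f 0 + g 0)) (∑-+ n (f ∘ suc) (g ∘ suc))) (interchange (f 0) (g 0) _ _)
    where
    interchange : ∀ a b c d → a + b + (c + d) ≡ a + c + (b + d)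
    interchange = solve-∀

  ∑-*ˡ : ∀ n a (f : ℕ → ℤ) → ∑ n (λ i → a * f i) ≡ a * ∑ n f
  ∑-*ˡ zero    a f = sym (ℤ.*-zeroʳ a)
  ∑-*ˡ (suc n) a f = trans (cong (_+_ (a * f 0)) (∑-*ˡ n a (f ∘ suc))) (sym (ℤ.*-distribˡ-+ a (f 0) _))

  ∑-*ʳ : ∀ n (f : ℕ → ℤ) a → ∑ n (λ i → f i * a) ≡ ∑ n f * a
  ∑-*ʳ n f a = trans (∑-cong n (λ i → ℤ.*-comm (f i) a)) (trans (∑-*ˡ n a f) (ℤ.*-comm a _))

  ∑-- : ∀ n (f g : ℕ → ℤ) → ∑ n (λ i → f i - g i) ≡ ∑ n f - ∑ n g
  ∑-- zero    f g = refl
  ∑-- (suc n) f g = trans (cong (_+_ (f 0 - g 0)) (∑-- n (f ∘ suc) (g ∘ suc))) (interchange (f 0) (g 0) _ _)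
    where
    interchange : ∀ a b c d → a - b + (c - d) ≡ a + c - (b + d)
    interchange = solve-∀

  ∑-zero : ∀ n → ∑ n (λ _ → 0ℤ) ≡ 0ℤ
  ∑-zero zero    = refl
  ∑-zero (suc n) = trans (ℤ.+-identityˡ _) (∑-zero n)

  ∑-swap : ∀ m n (F : ℕ → ℕ → ℤ) → ∑ m (λ i → ∑ n (F i)) ≡ ∑ n (λ j → ∑ m (λ i → F i j))
  ∑-swap zero    n F = sym (∑-zero n)
  ∑-swap (suc m) n F = trans (cong (_+_ (∑ n (F 0))) (∑-swap m n (F ∘ suc))) (sym (∑-+ n (F 0) _))

  ∑-const : ∀ n a → ∑ n (λ _ → a) ≡ + n * a
  ∑-const zero    a = sym (ℤ.*-zeroˡ a)
  ∑-const (suc n) a = trans (cong (_+_ a) (∑-const n a)) (succ-* (+ n) a)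
    where
    succ-* : ∀ n a → a + n * a ≡ (1ℤ + n) * a
    succ-* = solve-∀

  ∑-deficit : ∀ N (a : ℕ → ℤ) → ∑ N (λ d → a 0 - a (suc d)) ≡ + suc N * a 0 - ∑ (suc N) a
  ∑-deficit N a = begin
    ∑ N (λ d → a 0 - a (suc d))            ≡⟨ ∑-- N (λ _ → a 0) (a ∘ suc) ⟩
    ∑ N (λ _ → a 0) - ∑ N (a ∘ suc)        ≡⟨ cong (_- ∑ N (a ∘ suc)) (∑-const N (a 0)) ⟩
    + N * a 0 - ∑ N (a ∘ suc)              ≡⟨ absorb (+ N) (a 0) (∑ N (a ∘ suc)) ⟩
    (1ℤ + + N) * a 0 - (a 0 + ∑ N (a ∘ suc)) ∎
    where
    open ≡-Reasoning
    absorb : ∀ n a₀ t → n * a₀ - t ≡ (1ℤ + n) * a₀ - (a₀ + t)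
    absorb = solve-∀

  ∑-split : ∀ m n (f : ℕ → ℤ) → ∑ (m ℕ.+ n) f ≡ ∑ m f + ∑ n (λ i → f (m ℕ.+ i))
  ∑-split zero    n f = sym (ℤ.+-identityˡ _)
  ∑-split (suc m) n f = trans (cong (_+_ (f 0)) (∑-split m n (f ∘ suc))) (sym (ℤ.+-assoc (f 0) _ _))

  ∑-last : ∀ n (f : ℕ → ℤ) → ∑ (suc n) f ≡ ∑ n f + f n
  ∑-last zero    f = ℤ.+-comm (f 0) 0ℤ
  ∑-last (suc n) f = trans (cong (_+_ (f 0)) (∑-last n (f ∘ suc))) (sym (ℤ.+-assoc (f 0) _ _))

  ∑-blocks : ∀ t B (f : ℕ → ℤ) → ∑ (t ℕ.* B) f ≡ ∑ t (λ q → ∑ B (λ u → f (q ℕ.* B ℕ.+ u)))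
  ∑-blocks zero    B f = refl
  ∑-blocks (suc t) B f = begin
    ∑ (B ℕ.+ t ℕ.* B) f                                              ≡⟨ ∑-split B (t ℕ.* B) f ⟩
    ∑ B f + ∑ (t ℕ.* B) (λ i → f (B ℕ.+ i))                            ≡⟨ cong (_+_ (∑ B f)) (∑-blocks t B (λ i → f (B ℕ.+ i))) ⟩
    ∑ B f + ∑ t (λ q → ∑ B (λ u → f (B ℕ.+ (q ℕ.* B ℕ.+ u))))          ≡⟨ cong (_+_ (∑ B f)) (∑-cong t λ q → ∑-cong B λ u →
                                                                          cong f (sym (ℕ.+-assoc B (q ℕ.* B) u))) ⟩
    ∑ B f + ∑ t (λ q → ∑ B (λ u → f (suc q ℕ.* B ℕ.+ u)))              ∎
    where open ≡-Reasoning

  ∑-mono-≤ᵇ : ∀ n {f g : ℕ → ℤ} → (∀ i → i ℕ.< n → f i ≤ g i) → ∑ n f ≤ ∑ n g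
  ∑-mono-≤ᵇ zero    f≤g = ℤ.≤-refl
  ∑-mono-≤ᵇ (suc n) f≤g = ℤ.+-mono-≤ (f≤g 0 (ℕ.s≤s ℕ.z≤n)) (∑-mono-≤ᵇ n (λ i i<n → f≤g (suc i) (ℕ.s≤s i<n)))

  ∑-mono-≤ : ∀ n {f g : ℕ → ℤ} → (∀ i → f i ≤ g i) → ∑ n f ≤ ∑ n g
  ∑-mono-≤ n f≤g = ∑-mono-≤ᵇ n (λ i _ → f≤g i)

  ∑-nonNeg : ∀ n {f : ℕ → ℤ} → (∀ i → 0ℤ ≤ f i) → 0ℤ ≤ ∑ n f
  ∑-nonNeg n {f} 0≤f = subst (_≤ ∑ n f) (∑-zero n) (∑-mono-≤ n 0≤f)

  term-≤-∑ : ∀ n {f : ℕ → ℤ} → (∀ i → 0ℤ ≤ f i) → ∀ {j} → j ℕ.< n → f j ≤ ∑ n f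
  term-≤-∑ (suc n) {f} 0≤f {zero}  _           =
    ℤ.i≤i+j (f 0) (∑ n (f ∘ suc)) {{nonNegative (∑-nonNeg n (0≤f ∘ suc))}}
  term-≤-∑ (suc n) {f} 0≤f {suc j} (ℕ.s≤s j<n) =
    ℤ.i≤j⇒i≤k+j (f 0) {{nonNegative (0≤f 0)}} (term-≤-∑ n (0≤f ∘ suc) j<n)

  Periodic : ℕ → (ℕ → ℤ) → Set
  Periodic P f = ∀ m → f (m ℕ.+ P) ≡ f m

  ∑-rotate₁ : ∀ P {f : ℕ → ℤ} → Periodic P f → ∑ P (f ∘ suc) ≡ ∑ P f
  ∑-rotate₁ zero    per = refl
  ∑-rotate₁ (suc P) {f} per = begin
    ∑ (suc P) (f ∘ suc)        ≡⟨ ∑-last P (f ∘ suc) ⟩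
    ∑ P (f ∘ suc) + f (suc P)  ≡⟨ cong (_+_ (∑ P (f ∘ suc))) (per 0) ⟩
    ∑ P (f ∘ suc) + f 0        ≡⟨ ℤ.+-comm _ (f 0) ⟩
    f 0 + ∑ P (f ∘ suc)        ∎
    where open ≡-Reasoning

  ∑-rotate : ∀ P {f : ℕ → ℤ} → Periodic P f → ∀ i → ∑ P (λ m → f (m ℕ.+ i)) ≡ ∑ P f
  ∑-rotate P {f} per zero = ∑-cong P (λ m → cong f (ℕ.+-identityʳ m))
  ∑-rotate P {f} per (suc i) = begin
    ∑ P (λ m → f (m ℕ.+ suc i))    ≡⟨ ∑-cong P (λ m → cong f (ℕ.+-suc m i)) ⟩
    ∑ P (λ m → f (suc (m ℕ.+ i)))  ≡⟨ ∑-rotate P (per ∘ suc) i ⟩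
    ∑ P (f ∘ suc)                  ≡⟨ ∑-rotate₁ P per ⟩
    ∑ P f                          ∎
    where open ≡-Reasoning

module Correlation where
  open Sums
  open import Data.Nat as ℕ using (ℕ; zero; suc)
  import Data.Nat.Properties as ℕ
  import Data.Nat.Tactic.RingSolver as ℕ-Solver
  open import Data.Bool using (true; false; if_then_else_)
  open import Data.Integer using (ℤ; +_; -[1+_]; 0ℤ; 1ℤ; -1ℤ; _+_; _*_; _-_; _≤_; +≤+; nonNegative)
  import Data.Integer.Properties as ℤ
  open import Data.Integer.Tactic.RingSolver using (solve-∀)
  open import Data.Product using (Σ-syntax; _×_; _,_)
  open import Function using (_∘_)
  open import Relation.Binary.PropositionalEquality

  square-nonNeg : ∀ a → 0ℤ ≤ a * a
  square-nonNeg (+ n)    = subst (0ℤ ≤_) (ℤ.pos-* n n) (+≤+ ℕ.z≤n)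
  square-nonNeg -[1+ n ] = +≤+ ℕ.z≤n

  *-nonNeg : ∀ {a b} → 0ℤ ≤ a → 0ℤ ≤ b → 0ℤ ≤ a * b
  *-nonNeg {a} {b} 0≤a 0≤b = subst (_≤ a * b) (ℤ.*-zeroʳ a) (ℤ.*-monoˡ-≤-nonNeg a {{nonNegative 0≤a}} 0≤b)

  *-monoˡ-≤-0≤ : ∀ {a b c} → 0ℤ ≤ c → a ≤ b → c * a ≤ c * b
  *-monoˡ-≤-0≤ {c = c} 0≤c = ℤ.*-monoˡ-≤-nonNeg c {{nonNegative 0≤c}}

  periodic-shift : ∀ {P v} → Periodic P v → ∀ e → Periodic P (λ m → v (m ℕ.+ e))
  periodic-shift {P} {v} per e m = trans (cong v (+-swap m P e)) (per (m ℕ.+ e))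
    where
    +-swap : ∀ m P e → m ℕ.+ P ℕ.+ e ≡ m ℕ.+ e ℕ.+ P
    +-swap = ℕ-Solver.solve-∀

  periodic-* : ∀ {P u w} → Periodic P u → Periodic P w → Periodic P (λ m → u m * w m)
  periodic-* per-u per-w m = cong₂ _*_ (per-u m) (per-w m)

  autocorr : ℕ → (ℕ → ℤ) → ℕ → ℤ
  autocorr P v e = ∑ P (λ m → v m * v (m ℕ.+ e))

  autocorr₀ : ∀ P v → autocorr P v 0 ≡ ∑ P (λ m → v m * v m)
  autocorr₀ P v = ∑-cong P (λ m → cong (λ i → v m * v i) (ℕ.+-identityʳ m))

  autocorr₀-nonNeg : ∀ P v → 0ℤ ≤ autocorr P v 0
  autocorr₀-nonNeg P v = subst (0ℤ ≤_) (sym (autocorr₀ P v)) (∑-nonNeg P (λ m → square-nonNeg (v m)))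

  autocorr-shift : ∀ P {v} → Periodic P v → ∀ e → autocorr P (v ∘ suc) e ≡ autocorr P v e
  autocorr-shift P per e = ∑-rotate₁ P (periodic-* per (periodic-shift per e))

  autocorr-≤-autocorr₀ : ∀ P {v} → Periodic P v → ∀ e → autocorr P v e ≤ autocorr P v 0
  autocorr-≤-autocorr₀ P {v} per e = ℤ.*-cancelˡ-≤-pos _ _ (+ 2) (begin
    + 2 * autocorr P v e                               ≡⟨ sym (∑-*ˡ P (+ 2) _) ⟩
    ∑ P (λ m → + 2 * (v m * v (m ℕ.+ e)))             ≤⟨ ∑-mono-≤ P (λ m → two-products-≤-squares (v m) (v (m ℕ.+ e))) ⟩
    ∑ P (λ m → v m * v m + v (m ℕ.+ e) * v (m ℕ.+ e)) ≡⟨ ∑-+ P _ _ ⟩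
    ∑ P (λ m → v m * v m) + ∑ P (λ m → v (m ℕ.+ e) * v (m ℕ.+ e))
      ≡⟨ cong (_+_ (∑ P (λ m → v m * v m))) (∑-rotate P (periodic-* per per) e) ⟩
    ∑ P (λ m → v m * v m) + ∑ P (λ m → v m * v m)     ≡⟨ cong₂ _+_ (sym (autocorr₀ P v)) (sym (autocorr₀ P v)) ⟩
    autocorr P v 0 + autocorr P v 0                    ≡⟨ sym (double (autocorr P v 0)) ⟩
    + 2 * autocorr P v 0                               ∎)
    where
    open ℤ.≤-Reasoning
    double : ∀ a → + 2 * a ≡ a + a
    double = solve-∀
    expand-square : ∀ a b → + 2 * (a * b) + (a - b) * (a - b) ≡ a * a + b * b
    expand-square = solve-∀
    two-products-≤-squares : ∀ a b → + 2 * (a * b) ≤ a * a + b * b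
    two-products-≤-squares a b = subst (+ 2 * (a * b) ≤_) (expand-square a b)
      (ℤ.i≤i+j _ ((a - b) * (a - b)) {{nonNegative (square-nonNeg (a - b))}})

  -- pairSum g n x = Σ_{i<j<n} x i * x j * g (j − i)
  pairSum : (ℕ → ℤ) → ℕ → (ℕ → ℤ) → ℤ
  pairSum g zero    x = 0ℤ
  pairSum g (suc n) x = x 0 * ∑ n (λ j → x (suc j) * g (suc j)) + pairSum g n (x ∘ suc)

  pairSum-cong : ∀ n {f g x y : ℕ → ℤ} → (∀ e → f e ≡ g e) → (∀ i → x i ≡ y i) → pairSum f n x ≡ pairSum g n y
  pairSum-cong zero    f≡g x≡y = refl
  pairSum-cong (suc n) f≡g x≡y = cong₂ _+_
    (cong₂ _*_ (x≡y 0) (∑-cong n (λ j → cong₂ _*_ (x≡y (suc j)) (f≡g (suc j)))))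
    (pairSum-cong n f≡g (x≡y ∘ suc))

  square-∑ : ∀ n (a : ℕ → ℤ) → ∑ n a * ∑ n a ≡ ∑ n (λ i → a i * a i) + + 2 * pairSum (λ _ → 1ℤ) n a
  square-∑ zero    a = refl
  square-∑ (suc n) a = begin
    (a 0 + T) * (a 0 + T)                                  ≡⟨ square-+ (a 0) T ⟩
    a 0 * a 0 + T * T + + 2 * (a 0 * T)                    ≡⟨ cong₂ (λ u w → a 0 * a 0 + u + + 2 * (a 0 * w))
                                                                (square-∑ n (a ∘ suc)) (∑-cong n (λ j → sym (ℤ.*-identityʳ _))) ⟩
    a 0 * a 0 + (Q + + 2 * R) + + 2 * (a 0 * T₁)            ≡⟨ regroup (a 0 * a 0) Q R (a 0 * T₁) ⟩
    a 0 * a 0 + Q + + 2 * (a 0 * T₁ + R)                    ∎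
    where
    open ≡-Reasoning
    T  = ∑ n (a ∘ suc)
    T₁ = ∑ n (λ j → a (suc j) * 1ℤ)
    Q  = ∑ n (λ i → a (suc i) * a (suc i))
    R  = pairSum (λ _ → 1ℤ) n (a ∘ suc)
    square-+ : ∀ a t → (a + t) * (a + t) ≡ a * a + t * t + + 2 * (a * t)
    square-+ = solve-∀
    regroup : ∀ a q r t → a + (q + + 2 * r) + + 2 * t ≡ a + q + + 2 * (t + r)
    regroup = solve-∀

  ∑-pairSum-autocorr : ∀ n P {v} → Periodic P v → (x : ℕ → ℤ) →
    ∑ P (λ m → pairSum (λ _ → 1ℤ) n (λ i → x i * v (m ℕ.+ i))) ≡ pairSum (autocorr P v) n x
  ∑-pairSum-autocorr zero    P per x = ∑-zero P
  ∑-pairSum-autocorr (suc n) P {v} per x = begin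
    ∑ P (λ m → first m + rest m)  ≡⟨ ∑-+ P first rest ⟩
    ∑ P first + ∑ P rest          ≡⟨ cong₂ _+_ first-pairs rest-pairs ⟩
    x 0 * ∑ n (λ j → x (suc j) * autocorr P v (suc j)) + pairSum (autocorr P v) n (x ∘ suc) ∎
    where
    open ≡-Reasoning
    later first rest : ℕ → ℤ
    later m = ∑ n (λ j → x (suc j) * v (m ℕ.+ suc j) * 1ℤ)
    first m = x 0 * v (m ℕ.+ 0) * later m
    rest  m = pairSum (λ _ → 1ℤ) n (λ j → x (suc j) * v (m ℕ.+ suc j))
    rearrange : ∀ x₀ w x₁ w₁ → x₀ * w * (x₁ * w₁ * 1ℤ) ≡ x₀ * (x₁ * (w * w₁))
    rearrange = solve-∀
    first-pairs : ∑ P first ≡ x 0 * ∑ n (λ j → x (suc j) * autocorr P v (suc j))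
    first-pairs = begin
      ∑ P first
        ≡⟨ ∑-cong P (λ m → begin
             first m                                                           ≡⟨ cong (λ i → x 0 * v i * later m) (ℕ.+-identityʳ m) ⟩
             x 0 * v m * ∑ n (λ j → x (suc j) * v (m ℕ.+ suc j) * 1ℤ)           ≡⟨ sym (∑-*ˡ n (x 0 * v m) _) ⟩
             ∑ n (λ j → x 0 * v m * (x (suc j) * v (m ℕ.+ suc j) * 1ℤ))
               ≡⟨ ∑-cong n (λ j → rearrange (x 0) (v m) (x (suc j)) (v (m ℕ.+ suc j))) ⟩
             ∑ n (λ j → x 0 * (x (suc j) * (v m * v (m ℕ.+ suc j))))           ≡⟨ ∑-*ˡ n (x 0) _ ⟩
             x 0 * ∑ n (λ j → x (suc j) * (v m * v (m ℕ.+ suc j)))             ∎) ⟩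
      ∑ P (λ m → x 0 * ∑ n (λ j → x (suc j) * (v m * v (m ℕ.+ suc j))))        ≡⟨ ∑-*ˡ P (x 0) _ ⟩
      x 0 * ∑ P (λ m → ∑ n (λ j → x (suc j) * (v m * v (m ℕ.+ suc j))))        ≡⟨ cong (x 0 *_) (∑-swap P n _) ⟩
      x 0 * ∑ n (λ j → ∑ P (λ m → x (suc j) * (v m * v (m ℕ.+ suc j))))        ≡⟨ cong (x 0 *_) (∑-cong n (λ j → ∑-*ˡ P (x (suc j)) _)) ⟩
      x 0 * ∑ n (λ j → x (suc j) * autocorr P v (suc j))                       ∎
    rest-pairs : ∑ P rest ≡ pairSum (autocorr P v) n (x ∘ suc)
    rest-pairs = begin
      ∑ P rest
        ≡⟨ ∑-cong P (λ m → pairSum-cong n (λ _ → refl) (λ j → cong (λ i → x (suc j) * v i) (ℕ.+-suc m j))) ⟩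
      ∑ P (λ m → pairSum (λ _ → 1ℤ) n (λ j → x (suc j) * v (suc (m ℕ.+ j))))
        ≡⟨ ∑-pairSum-autocorr n P (per ∘ suc) (x ∘ suc) ⟩
      pairSum (autocorr P (v ∘ suc)) n (x ∘ suc)
        ≡⟨ pairSum-cong n (autocorr-shift P per) (λ _ → refl) ⟩
      pairSum (autocorr P v) n (x ∘ suc) ∎

  ∑-squares-autocorr : ∀ n P {v} → Periodic P v → (x : ℕ → ℤ) →
    ∑ P (λ m → ∑ n (λ i → (x i * v (m ℕ.+ i)) * (x i * v (m ℕ.+ i)))) ≡ ∑ n (λ i → x i * x i) * autocorr P v 0
  ∑-squares-autocorr n P {v} per x = begin
    ∑ P (λ m → ∑ n (λ i → (x i * v (m ℕ.+ i)) * (x i * v (m ℕ.+ i))))  ≡⟨ ∑-swap P n _ ⟩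
    ∑ n (λ i → ∑ P (λ m → (x i * v (m ℕ.+ i)) * (x i * v (m ℕ.+ i))))  ≡⟨ ∑-cong n (λ i → ∑-cong P (λ m → square-* (x i) (v (m ℕ.+ i)))) ⟩
    ∑ n (λ i → ∑ P (λ m → x i * x i * (v (m ℕ.+ i) * v (m ℕ.+ i))))    ≡⟨ ∑-cong n (λ i → ∑-*ˡ P (x i * x i) _) ⟩
    ∑ n (λ i → x i * x i * ∑ P (λ m → v (m ℕ.+ i) * v (m ℕ.+ i)))      ≡⟨ ∑-cong n (λ i → cong (x i * x i *_) (begin
      ∑ P (λ m → v (m ℕ.+ i) * v (m ℕ.+ i))                                ≡⟨ ∑-rotate P (periodic-* per per) i ⟩
      ∑ P (λ m → v m * v m)                                                ≡⟨ sym (autocorr₀ P v) ⟩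
      autocorr P v 0                                                       ∎)) ⟩
    ∑ n (λ i → x i * x i * autocorr P v 0)                             ≡⟨ ∑-*ʳ n _ (autocorr P v 0) ⟩
    ∑ n (λ i → x i * x i) * autocorr P v 0                             ∎
    where
    open ≡-Reasoning
    square-* : ∀ a b → (a * b) * (a * b) ≡ a * a * (b * b)
    square-* = solve-∀

  autocorr-positive-semidefinite : ∀ n P {v} → Periodic P v → (x : ℕ → ℤ) →
    0ℤ ≤ ∑ n (λ i → x i * x i) * autocorr P v 0 + + 2 * pairSum (autocorr P v) n x
  autocorr-positive-semidefinite n P {v} per x = subst (0ℤ ≤_) sum-of-squares (∑-nonNeg P (λ m → square-nonNeg (∑ n (a m))))
    where
    open ≡-Reasoning
    a : ℕ → ℕ → ℤ
    a m i = x i * v (m ℕ.+ i)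
    sum-of-squares : ∑ P (λ m → ∑ n (a m) * ∑ n (a m)) ≡ ∑ n (λ i → x i * x i) * autocorr P v 0 + + 2 * pairSum (autocorr P v) n x
    sum-of-squares = begin
      ∑ P (λ m → ∑ n (a m) * ∑ n (a m))
        ≡⟨ ∑-cong P (λ m → square-∑ n (a m)) ⟩
      ∑ P (λ m → ∑ n (λ i → a m i * a m i) + + 2 * pairSum (λ _ → 1ℤ) n (a m))
        ≡⟨ ∑-+ P _ _ ⟩
      ∑ P (λ m → ∑ n (λ i → a m i * a m i)) + ∑ P (λ m → + 2 * pairSum (λ _ → 1ℤ) n (a m))
        ≡⟨ cong₂ _+_ (∑-squares-autocorr n P per x) (∑-*ˡ P (+ 2) _) ⟩
      ∑ n (λ i → x i * x i) * autocorr P v 0 + + 2 * ∑ P (λ m → pairSum (λ _ → 1ℤ) n (a m))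
        ≡⟨ cong (λ t → ∑ n (λ i → x i * x i) * autocorr P v 0 + + 2 * t) (∑-pairSum-autocorr n P per x) ⟩
      ∑ n (λ i → x i * x i) * autocorr P v 0 + + 2 * pairSum (autocorr P v) n x ∎

  pairSum-+ : ∀ n (f g x : ℕ → ℤ) → pairSum (λ e → f e + g e) n x ≡ pairSum f n x + pairSum g n x
  pairSum-+ zero    f g x = refl
  pairSum-+ (suc n) f g x = begin
    x 0 * ∑ n (λ j → x (suc j) * (f (suc j) + g (suc j))) + pairSum (λ e → f e + g e) n (x ∘ suc)
      ≡⟨ cong₂ (λ s t → x 0 * s + t)
           (trans (∑-cong n (λ j → ℤ.*-distribˡ-+ (x (suc j)) _ _)) (∑-+ n _ _)) (pairSum-+ n f g (x ∘ suc)) ⟩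
    x 0 * (F + G) + (pairSum f n (x ∘ suc) + pairSum g n (x ∘ suc))
      ≡⟨ regroup (x 0) F G _ _ ⟩
    (x 0 * F + pairSum f n (x ∘ suc)) + (x 0 * G + pairSum g n (x ∘ suc)) ∎
    where
    open ≡-Reasoning
    F = ∑ n (λ j → x (suc j) * f (suc j))
    G = ∑ n (λ j → x (suc j) * g (suc j))
    regroup : ∀ a s t u w → a * (s + t) + (u + w) ≡ (a * s + u) + (a * t + w)
    regroup = solve-∀

  pairSum-*ˡ : ∀ n a (f x : ℕ → ℤ) → pairSum (λ e → a * f e) n x ≡ a * pairSum f n x
  pairSum-*ˡ zero    a f x = sym (ℤ.*-zeroʳ a)
  pairSum-*ˡ (suc n) a f x = begin
    x 0 * ∑ n (λ j → x (suc j) * (a * f (suc j))) + pairSum (λ e → a * f e) n (x ∘ suc)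
      ≡⟨ cong₂ (λ s t → x 0 * s + t)
           (trans (∑-cong n (λ j → swap-scalar (x (suc j)) a _)) (∑-*ˡ n a _)) (pairSum-*ˡ n a f (x ∘ suc)) ⟩
    x 0 * (a * F) + a * pairSum f n (x ∘ suc)
      ≡⟨ factor (x 0) a F _ ⟩
    a * (x 0 * F + pairSum f n (x ∘ suc)) ∎
    where
    open ≡-Reasoning
    F = ∑ n (λ j → x (suc j) * f (suc j))
    swap-scalar : ∀ y a b → y * (a * b) ≡ a * (y * b)
    swap-scalar = solve-∀
    factor : ∀ y a s t → y * (a * s) + a * t ≡ a * (y * s + t)
    factor = solve-∀

  pairSum-∑ : ∀ n M (F : ℕ → ℕ → ℤ) (x : ℕ → ℤ) →
    pairSum (λ e → ∑ M (λ d → F d e)) n x ≡ ∑ M (λ d → pairSum (F d) n x)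
  pairSum-∑ zero    M F x = sym (∑-zero M)
  pairSum-∑ (suc n) M F x = begin
    x 0 * ∑ n (λ j → x (suc j) * ∑ M (λ d → F d (suc j))) + pairSum (λ e → ∑ M (λ d → F d e)) n (x ∘ suc)
      ≡⟨ cong₂ (λ s t → x 0 * s + t) (trans (∑-cong n (λ j → sym (∑-*ˡ M (x (suc j)) _))) (∑-swap n M _))
           (pairSum-∑ n M F (x ∘ suc)) ⟩
    x 0 * ∑ M (λ d → ∑ n (λ j → x (suc j) * F d (suc j))) + ∑ M (λ d → pairSum (F d) n (x ∘ suc))
      ≡⟨ cong (_+ ∑ M (λ d → pairSum (F d) n (x ∘ suc))) (sym (∑-*ˡ M (x 0) _)) ⟩
    ∑ M (λ d → x 0 * ∑ n (λ j → x (suc j) * F d (suc j))) + ∑ M (λ d → pairSum (F d) n (x ∘ suc))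
      ≡⟨ sym (∑-+ M _ _) ⟩
    ∑ M (λ d → pairSum (F d) (suc n) x) ∎
    where open ≡-Reasoning

  pairSum-mono-≤ : ∀ n {f g x : ℕ → ℤ} → (∀ i → 0ℤ ≤ x i) → (∀ e → f e ≤ g e) → pairSum f n x ≤ pairSum g n x
  pairSum-mono-≤ zero    0≤x f≤g = ℤ.≤-refl
  pairSum-mono-≤ (suc n) 0≤x f≤g = ℤ.+-mono-≤
    (*-monoˡ-≤-0≤ (0≤x 0) (∑-mono-≤ n (λ j → *-monoˡ-≤-0≤ (0≤x (suc j)) (f≤g (suc j)))))
    (pairSum-mono-≤ n (0≤x ∘ suc) f≤g)

  pairSum-nonNeg : ∀ n {g x : ℕ → ℤ} → (∀ i → 0ℤ ≤ x i) → (∀ e → 0ℤ ≤ g e) → 0ℤ ≤ pairSum g n x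
  pairSum-nonNeg zero    0≤x 0≤g = ℤ.≤-refl
  pairSum-nonNeg (suc n) 0≤x 0≤g = ℤ.+-mono-≤ {0ℤ} {_} {0ℤ}
    (*-nonNeg (0≤x 0) (∑-nonNeg n (λ j → *-nonNeg (0≤x (suc j)) (0≤g (suc j)))))
    (pairSum-nonNeg n (0≤x ∘ suc) 0≤g)

  pair-≤-pairSum : ∀ n {g x : ℕ → ℤ} → (∀ i → 0ℤ ≤ x i) → (∀ e → 0ℤ ≤ g e) →
    ∀ i d → i ℕ.+ suc d ℕ.< n → x i * (x (i ℕ.+ suc d) * g (suc d)) ≤ pairSum g n x
  pair-≤-pairSum (suc n) {g} {x} 0≤x 0≤g zero d (ℕ.s≤s d<n) =
    ℤ.≤-trans (*-monoˡ-≤-0≤ (0≤x 0) (term-≤-∑ n (λ j → *-nonNeg (0≤x (suc j)) (0≤g (suc j))) d<n))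
              (ℤ.i≤i+j _ _ {{nonNegative (pairSum-nonNeg n (0≤x ∘ suc) 0≤g)}})
  pair-≤-pairSum (suc n) {g} {x} 0≤x 0≤g (suc i) d (ℕ.s≤s i+d<n) =
    ℤ.≤-trans (pair-≤-pairSum n (0≤x ∘ suc) 0≤g i d i+d<n)
              (ℤ.i≤j+i _ _ {{nonNegative (*-nonNeg (0≤x 0) (∑-nonNeg n (λ j → *-nonNeg (0≤x (suc j)) (0≤g (suc j)))))}})

  δ : ℕ → ℕ → ℤ
  δ e d = if e ℕ.≡ᵇ d then 1ℤ else 0ℤ

  δ-nonNeg : ∀ e d → 0ℤ ≤ δ e d
  δ-nonNeg e d with e ℕ.≡ᵇ d
  ... | true  = +≤+ ℕ.z≤n
  ... | false = +≤+ ℕ.z≤n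

  δ-refl : ∀ d → δ d d ≡ 1ℤ
  δ-refl zero    = refl
  δ-refl (suc d) = δ-refl d

  ∑-*0 : ∀ M (f : ℕ → ℤ) → ∑ M (λ d → f d * 0ℤ) ≡ 0ℤ
  ∑-*0 M f = trans (∑-cong M (λ d → ℤ.*-zeroʳ (f d))) (∑-zero M)

  ∑-*δ-≤ : ∀ M {f : ℕ → ℤ} → (∀ i → 0ℤ ≤ f i) → ∀ e → ∑ M (λ d → f d * δ e d) ≤ f e
  ∑-*δ-≤ zero    0≤f e       = 0≤f e
  ∑-*δ-≤ (suc M) {f} 0≤f zero = ℤ.≤-reflexive (begin
    f 0 * 1ℤ + ∑ M (λ d → f (suc d) * 0ℤ) ≡⟨ cong₂ _+_ (ℤ.*-identityʳ (f 0)) (∑-*0 M (f ∘ suc)) ⟩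
    f 0 + 0ℤ                              ≡⟨ ℤ.+-identityʳ (f 0) ⟩
    f 0                                   ∎)
    where open ≡-Reasoning
  ∑-*δ-≤ (suc M) {f} 0≤f (suc e) = subst (_≤ f (suc e)) (sym first-vanishes) (∑-*δ-≤ M (0≤f ∘ suc) e)
    where
    first-vanishes : f 0 * 0ℤ + ∑ M (λ d → f (suc d) * δ e d) ≡ ∑ M (λ d → f (suc d) * δ e d)
    first-vanishes = trans (cong (_+ ∑ M (λ d → f (suc d) * δ e d)) (ℤ.*-zeroʳ (f 0))) (ℤ.+-identityˡ _)

  ∑-*δ-suc-≤ : ∀ M {f : ℕ → ℤ} → (∀ i → 0ℤ ≤ f i) → ∀ e → ∑ M (λ d → f (suc d) * δ e (suc d)) ≤ f e
  ∑-*δ-suc-≤ M {f} 0≤f zero    = subst (_≤ f 0) (sym (∑-*0 M (f ∘ suc))) (0≤f 0)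
  ∑-*δ-suc-≤ M     0≤f (suc e) = ∑-*δ-≤ M (0≤f ∘ suc) e

  DifferenceBasis : ℕ → (ℕ → ℤ) → Set
  DifferenceBasis n x = ∀ d → suc d ℕ.< n → Σ[ i ∈ ℕ ] (i ℕ.+ suc d ℕ.< n × x i ≡ 1ℤ × x (i ℕ.+ suc d) ≡ 1ℤ)

  ∑-≤-pairSum : ∀ N {g x : ℕ → ℤ} → (∀ i → 0ℤ ≤ x i) → (∀ e → 0ℤ ≤ g e) → DifferenceBasis (suc N) x →
    ∑ N (g ∘ suc) ≤ pairSum g (suc N) x
  ∑-≤-pairSum N {g} {x} 0≤x 0≤g basis = begin
    ∑ N (g ∘ suc)                                                ≤⟨ ∑-mono-≤ᵇ N weighted ⟩
    ∑ N (λ d → g (suc d) * pairSum (λ e → δ e (suc d)) n x)      ≡⟨ ∑-cong N (λ d → sym (pairSum-*ˡ n (g (suc d)) _ x)) ⟩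
    ∑ N (λ d → pairSum (λ e → g (suc d) * δ e (suc d)) n x)      ≡⟨ sym (pairSum-∑ n N (λ d e → g (suc d) * δ e (suc d)) x) ⟩
    pairSum (λ e → ∑ N (λ d → g (suc d) * δ e (suc d))) n x      ≤⟨ pairSum-mono-≤ n 0≤x (∑-*δ-suc-≤ N 0≤g) ⟩
    pairSum g n x                                                ∎
    where
    open ℤ.≤-Reasoning
    n = suc N
    difference-occurs : ∀ d → d ℕ.< N → 1ℤ ≤ pairSum (λ e → δ e (suc d)) n x
    difference-occurs d d<N with basis d (ℕ.s≤s d<N)
    ... | i , i+d<n , xᵢ≡1 , xⱼ≡1 = subst (_≤ pairSum (λ e → δ e (suc d)) n x) one
      (pair-≤-pairSum n 0≤x (λ e → δ-nonNeg e (suc d)) i d i+d<n)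
      where
      one : x i * (x (i ℕ.+ suc d) * δ (suc d) (suc d)) ≡ 1ℤ
      one rewrite xᵢ≡1 | xⱼ≡1 | δ-refl d = refl
    weighted : ∀ d → d ℕ.< N → g (suc d) ≤ g (suc d) * pairSum (λ e → δ e (suc d)) n x
    weighted d d<N = subst (_≤ g (suc d) * pairSum (λ e → δ e (suc d)) n x) (ℤ.*-identityʳ (g (suc d)))
      (*-monoˡ-≤-0≤ (0≤g (suc d)) (difference-occurs d d<N))

  difference-basis-bound : ∀ N P {v x : ℕ → ℤ} → Periodic P v →
    (∀ i → 0ℤ ≤ x i) → (∀ i → x i * x i ≡ x i) → DifferenceBasis (suc N) x →
    + 2 * ∑ N (λ d → autocorr P v 0 - autocorr P v (suc d)) ≤ ∑ (suc N) x * ∑ (suc N) x * autocorr P v 0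
  difference-basis-bound N P {v} {x} per 0≤x x²≡x basis = begin
    + 2 * ∑ N (λ d → c₀ - c (suc d))       ≤⟨ ℤ.*-monoˡ-≤-nonNeg (+ 2) gaps-≤-pairs ⟩
    + 2 * pairSum (λ e → c₀ - c e) n x      ≡⟨ cong (+ 2 *_) pairs-linear ⟩
    + 2 * (c₀ * K₁ + -1ℤ * K)               ≤⟨ ℤ.i≤i+j _ _ {{nonNegative positivity}} ⟩
    + 2 * (c₀ * K₁ + -1ℤ * K) + (k * c₀ + + 2 * K) ≡⟨ collect c₀ K₁ K k ⟩
    (k + + 2 * K₁) * c₀                     ≡⟨ cong (_* c₀) (sym k²) ⟩
    k * k * c₀                              ∎
    where
    open ℤ.≤-Reasoning
    n  = suc N
    c  = autocorr P v
    c₀ = c 0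
    k  = ∑ n x
    K  = pairSum c n x
    K₁ = pairSum (λ _ → 1ℤ) n x
    gaps-≤-pairs : ∑ N (λ d → c₀ - c (suc d)) ≤ pairSum (λ e → c₀ - c e) n x
    gaps-≤-pairs = ∑-≤-pairSum N 0≤x (λ e → ℤ.i≤j⇒0≤j-i (autocorr-≤-autocorr₀ P per e)) basis
    as-combination : ∀ a b → a - b ≡ a * 1ℤ + -1ℤ * b
    as-combination = solve-∀
    pairs-linear : pairSum (λ e → c₀ - c e) n x ≡ c₀ * K₁ + -1ℤ * K
    pairs-linear = trans (pairSum-cong n {x = x} (λ e → as-combination c₀ (c e)) (λ _ → refl))
      (trans (pairSum-+ n _ _ x) (cong₂ _+_ (pairSum-*ˡ n c₀ _ x) (pairSum-*ˡ n -1ℤ c x)))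
    positivity : 0ℤ ≤ k * c₀ + + 2 * K
    positivity = subst (λ s → 0ℤ ≤ s * c₀ + + 2 * K) (∑-cong n x²≡x) (autocorr-positive-semidefinite n P per x)
    k² : k * k ≡ k + + 2 * K₁
    k² = trans (square-∑ n x) (cong (_+ + 2 * K₁) (∑-cong n x²≡x))
    collect : ∀ c₀ K₁ K k → + 2 * (c₀ * K₁ + -1ℤ * K) + (k * c₀ + + 2 * K) ≡ (k + + 2 * K₁) * c₀
    collect = solve-∀

module Stair where
  open Sums
  open Correlation
  open import Data.Nat as ℕ using (ℕ; zero; suc; NonZero; _/_)
  import Data.Nat.Properties as ℕ
  import Data.Nat.DivMod as ℕ
  open import Data.Nat.Divisibility using (n∣m*n)
  import Data.Nat.Tactic.RingSolver as ℕ-Solver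
  open import Data.Integer using (ℤ; +_; 0ℤ; 1ℤ; _+_; _*_; _-_; _≤_)
  import Data.Integer.Properties as ℤ
  open import Data.Integer.Tactic.RingSolver using (solve-∀)
  open import Relation.Binary.PropositionalEquality

  ∑-triangular : ∀ m → + 2 * ∑ m (λ i → + i) ≡ + m * (+ m - 1ℤ)
  ∑-triangular zero    = refl
  ∑-triangular (suc m) = begin
    + 2 * (0ℤ + ∑ m (λ i → 1ℤ + + i))        ≡⟨ cong (λ t → + 2 * (0ℤ + t)) (∑-+ m (λ _ → 1ℤ) (λ i → + i)) ⟩
    + 2 * (0ℤ + (∑ m (λ _ → 1ℤ) + ∑ m (λ i → + i)))
      ≡⟨ cong (λ t → + 2 * (0ℤ + (t + ∑ m (λ i → + i)))) (trans (∑-const m 1ℤ) (ℤ.*-identityʳ (+ m))) ⟩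
    + 2 * (0ℤ + (+ m + ∑ m (λ i → + i)))              ≡⟨ distribute (+ m) (∑ m (λ i → + i)) ⟩
    + 2 * + m + + 2 * ∑ m (λ i → + i)                 ≡⟨ cong (_+_ (+ 2 * + m)) (∑-triangular m) ⟩
    + 2 * + m + + m * (+ m - 1ℤ)             ≡⟨ next (+ m) ⟩
    (1ℤ + + m) * (1ℤ + + m - 1ℤ)             ∎
    where
    open ≡-Reasoning
    distribute : ∀ a t → + 2 * (0ℤ + (a + t)) ≡ + 2 * a + + 2 * t
    distribute = solve-∀
    next : ∀ a → + 2 * a + a * (a - 1ℤ) ≡ (1ℤ + a) * (1ℤ + a - 1ℤ)
    next = solve-∀

  ramp : ℤ → ℤ → ℤ → ℤ → ℤ
  ramp b X Y m = + 2 * (m * b) * X - m * (m - 1ℤ) * X + m * (m - 1ℤ) * Y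

  ∑-interpolation : ∀ B X Y m → + 2 * ∑ m (λ r → (+ B - + r) * X + + r * Y) ≡ ramp (+ B) X Y (+ m)
  ∑-interpolation B X Y m = begin
    + 2 * ∑ m (λ r → (+ B - + r) * X + + r * Y)         ≡⟨ cong (+ 2 *_) (∑-cong m (λ r → separate (+ B) (+ r) X Y)) ⟩
    + 2 * ∑ m (λ r → + B * X + (Y - X) * + r)            ≡⟨ cong (+ 2 *_) (∑-+ m (λ _ → + B * X) (λ r → (Y - X) * + r)) ⟩
    + 2 * (∑ m (λ _ → + B * X) + ∑ m (λ r → (Y - X) * + r))
      ≡⟨ cong₂ (λ u w → + 2 * (u + w)) (∑-const m (+ B * X)) (∑-*ˡ m (Y - X) (λ i → + i)) ⟩
    + 2 * (+ m * (+ B * X) + (Y - X) * ∑ m (λ i → + i))           ≡⟨ pull-2 (+ m) (+ B) X Y (∑ m (λ i → + i)) ⟩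
    + 2 * (+ m * + B) * X + (Y - X) * (+ 2 * ∑ m (λ i → + i))     ≡⟨ cong (λ t → + 2 * (+ m * + B) * X + (Y - X) * t) (∑-triangular m) ⟩
    + 2 * (+ m * + B) * X + (Y - X) * (+ m * (+ m - 1ℤ)) ≡⟨ expand (+ m) (+ B) X Y ⟩
    ramp (+ B) X Y (+ m)                                  ∎
    where
    open ≡-Reasoning
    separate : ∀ b r X Y → (b - r) * X + r * Y ≡ b * X + (Y - X) * r
    separate = solve-∀
    pull-2 : ∀ m b X Y t → + 2 * (m * (b * X) + (Y - X) * t) ≡ + 2 * (m * b) * X + (Y - X) * (+ 2 * t)
    pull-2 = solve-∀
    expand : ∀ m b X Y → + 2 * (m * b) * X + (Y - X) * (m * (m - 1ℤ)) ≡ + 2 * (m * b) * X - m * (m - 1ℤ) * X + m * (m - 1ℤ) * Y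
    expand = solve-∀

  ∑-ramp : ∀ t b (X Y : ℕ → ℤ) m → ∑ t (λ q → ramp b (X q) (Y q) m) ≡ ramp b (∑ t X) (∑ t Y) m
  ∑-ramp t b X Y m = begin
    ∑ t (λ q → ramp b (X q) (Y q) m)      ≡⟨ ∑-cong t (λ q → linear a c (X q) (Y q)) ⟩
    ∑ t (λ q → (a - c) * X q + c * Y q)   ≡⟨ ∑-+ t _ _ ⟩
    ∑ t (λ q → (a - c) * X q) + ∑ t (λ q → c * Y q) ≡⟨ cong₂ _+_ (∑-*ˡ t (a - c) X) (∑-*ˡ t c Y) ⟩
    (a - c) * ∑ t X + c * ∑ t Y           ≡⟨ sym (linear a c (∑ t X) (∑ t Y)) ⟩
    ramp b (∑ t X) (∑ t Y) m              ∎
    where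
    open ≡-Reasoning
    a = + 2 * (m * b)
    c = m * (m - 1ℤ)
    linear : ∀ a c X Y → a * X - c * X + c * Y ≡ (a - c) * X + c * Y
    linear = solve-∀

  module _ (s : ℕ) (h : ℕ → ℤ) (B : ℕ) .{{_ : NonZero B}} where

    stair : ℕ → ℤ
    stair j = h (j / B)

    stair-block : ∀ q {u} → u ℕ.< B → stair (q ℕ.* B ℕ.+ u) ≡ h q
    stair-block q {u} u<B = cong h (begin
      (q ℕ.* B ℕ.+ u) / B     ≡⟨ ℕ.+-distrib-/-∣ˡ u (n∣m*n q) ⟩
      q ℕ.* B / B ℕ.+ u / B   ≡⟨ cong₂ ℕ._+_ (ℕ.m*n/n≡m q B) (ℕ.m<n⇒m/n≡0 u<B) ⟩
      q ℕ.+ 0                 ≡⟨ ℕ.+-identityʳ q ⟩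
      q                       ∎)
      where open ≡-Reasoning

    stair-periodic : Periodic s h → Periodic (s ℕ.* B) stair
    stair-periodic per m = trans (cong h (begin
      (m ℕ.+ s ℕ.* B) / B     ≡⟨ ℕ.+-distrib-/-∣ʳ m (n∣m*n s) ⟩
      m / B ℕ.+ s ℕ.* B / B   ≡⟨ cong (m / B ℕ.+_) (ℕ.m*n/n≡m s B) ⟩
      m / B ℕ.+ s             ∎)) (per (m / B))
      where open ≡-Reasoning

    stair-window : ∀ p {r} → r ℕ.≤ B → ∑ B (λ u → stair (p ℕ.* B ℕ.+ u ℕ.+ r)) ≡ (+ B - + r) * h p + + r * h (suc p)
    stair-window p {r} r≤B = begin
      ∑ B f                                   ≡⟨ cong (λ n → ∑ n f) (sym w+r≡B) ⟩
      ∑ (w ℕ.+ r) f                           ≡⟨ ∑-split w r f ⟩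
      ∑ w f + ∑ r (λ u → f (w ℕ.+ u))         ≡⟨ cong₂ _+_ (∑-congᵇ w same-block) (∑-congᵇ r next-block) ⟩
      ∑ w (λ _ → h p) + ∑ r (λ _ → h (suc p)) ≡⟨ cong₂ _+_ (∑-const w (h p)) (∑-const r (h (suc p))) ⟩
      + w * h p + + r * h (suc p)             ≡⟨ cong (λ z → z * h p + + r * h (suc p)) +w≡B-r ⟩
      (+ B - + r) * h p + + r * h (suc p)     ∎
      where
      open ≡-Reasoning
      f : ℕ → ℤ
      f u = stair (p ℕ.* B ℕ.+ u ℕ.+ r)
      w = B ℕ.∸ r
      w+r≡B : w ℕ.+ r ≡ B
      w+r≡B = ℕ.m∸n+n≡m r≤B
      +w≡B-r : + w ≡ + B - + r
      +w≡B-r = trans (sym (ℤ.⊖-≥ r≤B)) (sym (ℤ.m-n≡m⊖n B r))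
      same-block : ∀ u → u ℕ.< w → f u ≡ h p
      same-block u u<w = trans (cong stair (ℕ.+-assoc (p ℕ.* B) u r))
        (stair-block p (subst (u ℕ.+ r ℕ.<_) w+r≡B (ℕ.+-monoˡ-< r u<w)))
      regroup : ∀ a w u r → a ℕ.+ (w ℕ.+ u) ℕ.+ r ≡ a ℕ.+ (w ℕ.+ r) ℕ.+ u
      regroup = ℕ-Solver.solve-∀
      next-block : ∀ u → u ℕ.< r → f (w ℕ.+ u) ≡ h (suc p)
      next-block u u<r = trans (cong stair (begin
        p ℕ.* B ℕ.+ (w ℕ.+ u) ℕ.+ r   ≡⟨ regroup (p ℕ.* B) w u r ⟩
        p ℕ.* B ℕ.+ (w ℕ.+ r) ℕ.+ u   ≡⟨ cong (λ b → p ℕ.* B ℕ.+ b ℕ.+ u) w+r≡B ⟩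
        p ℕ.* B ℕ.+ B ℕ.+ u           ≡⟨ cong (ℕ._+ u) (ℕ.+-comm (p ℕ.* B) B) ⟩
        suc p ℕ.* B ℕ.+ u             ∎))
        (stair-block (suc p) (ℕ.<-≤-trans u<r (subst (r ℕ.≤_) w+r≡B (ℕ.m≤n+m r w))))

    autocorr-stair : ∀ q {r} → r ℕ.≤ B →
      autocorr (s ℕ.* B) stair (q ℕ.* B ℕ.+ r) ≡ (+ B - + r) * autocorr s h q + + r * autocorr s h (suc q)
    autocorr-stair q {r} r≤B = begin
      ∑ (s ℕ.* B) (λ m → stair m * stair (m ℕ.+ (q ℕ.* B ℕ.+ r)))
        ≡⟨ ∑-blocks s B _ ⟩
      ∑ s (λ i → ∑ B (λ u → stair (i ℕ.* B ℕ.+ u) * stair (i ℕ.* B ℕ.+ u ℕ.+ (q ℕ.* B ℕ.+ r))))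
        ≡⟨ ∑-cong s block ⟩
      ∑ s (λ i → (+ B - + r) * (h i * h (i ℕ.+ q)) + + r * (h i * h (i ℕ.+ suc q)))
        ≡⟨ ∑-+ s _ _ ⟩
      ∑ s (λ i → (+ B - + r) * (h i * h (i ℕ.+ q))) + ∑ s (λ i → + r * (h i * h (i ℕ.+ suc q)))
        ≡⟨ cong₂ _+_ (∑-*ˡ s (+ B - + r) _) (∑-*ˡ s (+ r) _) ⟩
      (+ B - + r) * autocorr s h q + + r * autocorr s h (suc q) ∎
      where
      open ≡-Reasoning
      shift : ∀ i u q r b → i ℕ.* b ℕ.+ u ℕ.+ (q ℕ.* b ℕ.+ r) ≡ (i ℕ.+ q) ℕ.* b ℕ.+ u ℕ.+ r
      shift = ℕ-Solver.solve-∀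
      distribute : ∀ a b r y z → a * (b * y + r * z) ≡ b * (a * y) + r * (a * z)
      distribute = solve-∀
      block : ∀ i → ∑ B (λ u → stair (i ℕ.* B ℕ.+ u) * stair (i ℕ.* B ℕ.+ u ℕ.+ (q ℕ.* B ℕ.+ r)))
                  ≡ (+ B - + r) * (h i * h (i ℕ.+ q)) + + r * (h i * h (i ℕ.+ suc q))
      block i = begin
        ∑ B (λ u → stair (i ℕ.* B ℕ.+ u) * stair (i ℕ.* B ℕ.+ u ℕ.+ (q ℕ.* B ℕ.+ r)))
          ≡⟨ ∑-congᵇ B (λ u u<B → cong₂ _*_ (stair-block i u<B) (cong stair (shift i u q r B))) ⟩
        ∑ B (λ u → h i * stair ((i ℕ.+ q) ℕ.* B ℕ.+ u ℕ.+ r))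
          ≡⟨ ∑-*ˡ B (h i) _ ⟩
        h i * ∑ B (λ u → stair ((i ℕ.+ q) ℕ.* B ℕ.+ u ℕ.+ r))
          ≡⟨ cong (h i *_) (stair-window (i ℕ.+ q) r≤B) ⟩
        h i * ((+ B - + r) * h (i ℕ.+ q) + + r * h (suc (i ℕ.+ q)))
          ≡⟨ distribute (h i) (+ B - + r) (+ r) _ _ ⟩
        (+ B - + r) * (h i * h (i ℕ.+ q)) + + r * (h i * h (suc (i ℕ.+ q)))
          ≡⟨ cong (λ j → (+ B - + r) * (h i * h (i ℕ.+ q)) + + r * (h i * h j)) (sym (ℕ.+-suc i q)) ⟩
        (+ B - + r) * (h i * h (i ℕ.+ q)) + + r * (h i * h (i ℕ.+ suc q)) ∎

    autocorr-stair₀ : autocorr (s ℕ.* B) stair 0 ≡ + B * autocorr s h 0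
    autocorr-stair₀ = trans (autocorr-stair 0 ℕ.z≤n) (drop-zero (+ B) (autocorr s h 0) (autocorr s h 1))
      where
      drop-zero : ∀ b x y → (b - 0ℤ) * x + 0ℤ * y ≡ b * x
      drop-zero = solve-∀

    twiceAutocorrSum : ℕ → ℕ → ℤ
    twiceAutocorrSum t m = ∑ t (λ q → ramp (+ B) (C q) (C (suc q)) (+ B)) + ramp (+ B) (C t) (C (suc t)) (+ m)
      where C = autocorr s h

    twice-∑-autocorr-stair : ∀ t {m} → m ℕ.≤ B → + 2 * ∑ (t ℕ.* B ℕ.+ m) (autocorr (s ℕ.* B) stair) ≡ twiceAutocorrSum t m
    twice-∑-autocorr-stair t {m} m≤B = begin
      + 2 * ∑ (t ℕ.* B ℕ.+ m) c                                       ≡⟨ cong (+ 2 *_) (∑-split (t ℕ.* B) m c) ⟩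
      + 2 * (∑ (t ℕ.* B) c + ∑ m (λ r → c (t ℕ.* B ℕ.+ r)))           ≡⟨ ℤ.*-distribˡ-+ (+ 2) (∑ (t ℕ.* B) c) _ ⟩
      + 2 * ∑ (t ℕ.* B) c + + 2 * ∑ m (λ r → c (t ℕ.* B ℕ.+ r))       ≡⟨ cong₂ _+_ full-blocks (partial-block t m≤B) ⟩
      twiceAutocorrSum t m                                             ∎
      where
      open ≡-Reasoning
      c = autocorr (s ℕ.* B) stair
      partial-block : ∀ q {m} → m ℕ.≤ B →
        + 2 * ∑ m (λ r → c (q ℕ.* B ℕ.+ r)) ≡ ramp (+ B) (autocorr s h q) (autocorr s h (suc q)) (+ m)
      partial-block q {m} m≤B = trans
        (cong (+ 2 *_) (∑-congᵇ m (λ r r<m → autocorr-stair q (ℕ.<⇒≤ (ℕ.<-≤-trans r<m m≤B)))))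
        (∑-interpolation B _ _ m)
      full-blocks : + 2 * ∑ (t ℕ.* B) c ≡ ∑ t (λ q → ramp (+ B) (autocorr s h q) (autocorr s h (suc q)) (+ B))
      full-blocks = begin
        + 2 * ∑ (t ℕ.* B) c                                     ≡⟨ cong (+ 2 *_) (∑-blocks t B c) ⟩
        + 2 * ∑ t (λ q → ∑ B (λ r → c (q ℕ.* B ℕ.+ r)))         ≡⟨ sym (∑-*ˡ t (+ 2) _) ⟩
        ∑ t (λ q → + 2 * ∑ B (λ r → c (q ℕ.* B ℕ.+ r)))         ≡⟨ ∑-cong t (λ q → partial-block q ℕ.≤-refl) ⟩
        ∑ t (λ q → ramp (+ B) (autocorr s h q) (autocorr s h (suc q)) (+ B)) ∎

    -- For n = t B + m this is 2 Σ_{d<n−1} (c₀ − c (d + 1)), c the autocorrelation of the stair.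
    stairBound : ℕ → ℕ → ℤ
    stairBound t m = + 2 * + (t ℕ.* B ℕ.+ m) * (+ B * autocorr s h 0) - twiceAutocorrSum t m

    stair-bound : Periodic s h → ∀ N t {m} → t ℕ.* B ℕ.+ m ≡ suc N → m ℕ.≤ B →
      ∀ {x} → (∀ i → 0ℤ ≤ x i) → (∀ i → x i * x i ≡ x i) → DifferenceBasis (suc N) x →
      stairBound t m ≤ ∑ (suc N) x * ∑ (suc N) x * (+ B * autocorr s h 0)
    stair-bound per N t {m} n≡ m≤B {x} 0≤x x²≡x basis = begin
      stairBound t m                                    ≡⟨ cong₂ (λ n z → + 2 * + n * z - twiceAutocorrSum t m) n≡ (sym autocorr-stair₀) ⟩
      + 2 * + suc N * c₀ - twiceAutocorrSum t m         ≡⟨ cong (λ z → + 2 * + suc N * c₀ - z) (sym twice-∑) ⟩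
      + 2 * + suc N * c₀ - + 2 * ∑ (suc N) c            ≡⟨ sym (double-deficit (+ suc N) c₀ (∑ (suc N) c)) ⟩
      + 2 * (+ suc N * c₀ - ∑ (suc N) c)                ≡⟨ cong (+ 2 *_) (sym (∑-deficit N c)) ⟩
      + 2 * ∑ N (λ d → c₀ - c (suc d))                  ≤⟨ difference-basis-bound N (s ℕ.* B) (stair-periodic per) 0≤x x²≡x basis ⟩
      ∑ (suc N) x * ∑ (suc N) x * c₀                    ≡⟨ cong (∑ (suc N) x * ∑ (suc N) x *_) autocorr-stair₀ ⟩
      ∑ (suc N) x * ∑ (suc N) x * (+ B * autocorr s h 0) ∎
      where
      open ℤ.≤-Reasoning
      c  = autocorr (s ℕ.* B) stair
      c₀ = c 0
      twice-∑ : + 2 * ∑ (suc N) c ≡ twiceAutocorrSum t m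
      twice-∑ = subst (λ n → + 2 * ∑ n c ≡ twiceAutocorrSum t m) n≡ (twice-∑-autocorr-stair t m≤B)
      double-deficit : ∀ n a t → + 2 * (n * a - t) ≡ + 2 * n * a - + 2 * t
      double-deficit = solve-∀

module Letters where
  open Sums using (∑; Periodic)
  open Correlation using (DifferenceBasis; autocorr)
  open Stair using (stairBound; stair-bound)
  open import Data.Nat as ℕ using (ℕ; zero; suc; NonZero; _∸_)
  import Data.Nat.Properties as ℕ
  open import Data.Integer using (ℤ; +_; 0ℤ; 1ℤ; _+_; _*_; _≤_; +≤+)
  import Data.Integer.Properties as ℤ
  open import Data.List using ([]; _∷_; length; take; drop)
  open import Data.List.Properties using (length-take; length-drop; length-filter)
  open import Data.List.Relation.Binary.Pointwise using ([]; _∷_)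
  open import Data.Maybe using (just; nothing)
  open import Data.Product using (Σ-syntax; _×_; _,_)
  open import Data.Sum using (_⊎_; inj₁; inj₂; [_,_]′)
  open import Data.Empty using (⊥-elim)
  open import Data.Unit using (tt)
  open import Relation.Binary.PropositionalEquality

  letterIndicator : ∀ {k} → PartialWord k → ℕ → ℤ
  letterIndicator []           _       = 0ℤ
  letterIndicator (_ ∷ w)       (suc i) = letterIndicator w i
  letterIndicator (nothing ∷ _) zero    = 0ℤ
  letterIndicator (just _ ∷ _)  zero    = 1ℤ

  letterIndicator-nonNeg : ∀ {k} (w : PartialWord k) i → 0ℤ ≤ letterIndicator w i
  letterIndicator-nonNeg []            _       = +≤+ ℕ.z≤n
  letterIndicator-nonNeg (_ ∷ w)       (suc i) = letterIndicator-nonNeg w i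
  letterIndicator-nonNeg (nothing ∷ _) zero    = +≤+ ℕ.z≤n
  letterIndicator-nonNeg (just _ ∷ _)  zero    = +≤+ ℕ.z≤n

  letterIndicator-idem : ∀ {k} (w : PartialWord k) i → letterIndicator w i * letterIndicator w i ≡ letterIndicator w i
  letterIndicator-idem []            _       = refl
  letterIndicator-idem (_ ∷ w)       (suc i) = letterIndicator-idem w i
  letterIndicator-idem (nothing ∷ _) zero    = refl
  letterIndicator-idem (just _ ∷ _)  zero    = refl

  letters : ∀ {k} → PartialWord k → ℕ
  letters w = length w ∸ holes w

  ∑-letterIndicator : ∀ {k} (w : PartialWord k) → ∑ (length w) (letterIndicator w) ≡ + letters w
  ∑-letterIndicator []            = refl
  ∑-letterIndicator (nothing ∷ w) = trans (ℤ.+-identityˡ _) (∑-letterIndicator w)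
  ∑-letterIndicator (just _ ∷ w)  = trans (cong (_+_ 1ℤ) (∑-letterIndicator w))
    (cong +_ (sym (ℕ.+-∸-assoc 1 (length-filter isHole w))))

  compatible-or-clash : ∀ {k} (u v : PartialWord k) → length u ≡ length v →
    Compatible u v ⊎ Σ[ i ∈ ℕ ] (letterIndicator u i ≡ 1ℤ × letterIndicator v i ≡ 1ℤ × i ℕ.< length u)
  compatible-or-clash []            []           _  = inj₁ []
  compatible-or-clash (just _ ∷ _)  (just _ ∷ _) _  = inj₂ (0 , refl , refl , ℕ.s≤s ℕ.z≤n)
  compatible-or-clash (nothing ∷ u) (_ ∷ v)       eq with compatible-or-clash u v (ℕ.suc-injective eq)
  ... | inj₁ c                    = inj₁ (tt ∷ c)
  ... | inj₂ (i , uᵢ , vᵢ , i<n) = inj₂ (suc i , uᵢ , vᵢ , ℕ.s≤s i<n)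
  compatible-or-clash (just _ ∷ u)  (nothing ∷ v) eq with compatible-or-clash u v (ℕ.suc-injective eq)
  ... | inj₁ c                    = inj₁ (tt ∷ c)
  ... | inj₂ (i , uᵢ , vᵢ , i<n) = inj₂ (suc i , uᵢ , vᵢ , ℕ.s≤s i<n)

  letterIndicator-take : ∀ {k} m (w : PartialWord k) i → letterIndicator (take m w) i ≡ 1ℤ → letterIndicator w i ≡ 1ℤ
  letterIndicator-take zero    _             _       ()
  letterIndicator-take (suc m) []            _       ()
  letterIndicator-take (suc m) (_ ∷ w)       (suc i) ≡1 = letterIndicator-take m w i ≡1
  letterIndicator-take (suc m) (nothing ∷ _) zero    ()
  letterIndicator-take (suc m) (just _ ∷ _)  zero    _  = refl

  letterIndicator-drop : ∀ {k} m (w : PartialWord k) i → letterIndicator (drop m w) i ≡ letterIndicator w (m ℕ.+ i)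
  letterIndicator-drop zero    w       i = refl
  letterIndicator-drop (suc m) []      i = refl
  letterIndicator-drop (suc m) (_ ∷ w) i = letterIndicator-drop m w i

  unbordered-differenceBasis : ∀ {k} {w : PartialWord k} → Unbordered w → DifferenceBasis (length w) (letterIndicator w)
  unbordered-differenceBasis {w = w} unbordered d d<L =
    [ (λ compatible → ⊥-elim (unbordered m 1≤m m<L (subst (λ j → Compatible (take m w) (drop j w)) (sym L∸m≡d+1) compatible)))
    , (λ (i , uᵢ , vᵢ , i<|u|) → i , i+d<L i<|u| , letterIndicator-take m w i uᵢ , shifted-letter i vᵢ)
    ]′ (compatible-or-clash (take m w) (drop (suc d) w) same-length)
    where
    L = length w
    m = L ∸ suc d
    d+1≤L = ℕ.<⇒≤ d<L
    L∸m≡d+1 : L ∸ m ≡ suc d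
    L∸m≡d+1 = ℕ.m∸[m∸n]≡n d+1≤L
    1≤m : 1 ℕ.≤ m
    1≤m = ℕ.m<n⇒0<n∸m d<L
    m<L : m ℕ.< L
    m<L = ℕ.∸-monoʳ-< (ℕ.s≤s ℕ.z≤n) d+1≤L
    |u|≡m : length (take m w) ≡ m
    |u|≡m = trans (length-take m w) (ℕ.m≤n⇒m⊓n≡m (ℕ.m∸n≤m L (suc d)))
    same-length : length (take m w) ≡ length (drop (suc d) w)
    same-length = trans |u|≡m (sym (length-drop (suc d) w))
    i+d<L : ∀ {i} → i ℕ.< length (take m w) → i ℕ.+ suc d ℕ.< L
    i+d<L {i} i<|u| = subst (i ℕ.+ suc d ℕ.<_) (ℕ.m∸n+n≡m d+1≤L) (ℕ.+-monoˡ-< (suc d) (subst (i ℕ.<_) |u|≡m i<|u|))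
    shifted-letter : ∀ i → letterIndicator (drop (suc d) w) i ≡ 1ℤ → letterIndicator w (i ℕ.+ suc d) ≡ 1ℤ
    shifted-letter i vᵢ = trans (cong (letterIndicator w) (ℕ.+-comm i (suc d))) (trans (sym (letterIndicator-drop (suc d) w i)) vᵢ)

  unbordered-stair-bound : ∀ s h → Periodic s h → ∀ B .{{_ : NonZero B}} {k} {w : PartialWord k} → Unbordered w →
    ∀ N t {m} → length w ≡ suc N → t ℕ.* B ℕ.+ m ≡ suc N → m ℕ.≤ B →
    stairBound s h B t m ≤ + (letters w ℕ.* letters w) * (+ B * autocorr s h 0)
  unbordered-stair-bound s h per B {w = w} unbordered N t {m} |w|≡ n≡ m≤B =
    subst (λ z → stairBound s h B t m ≤ z * (+ B * autocorr s h 0)) square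
      (stair-bound s h B per N t n≡ m≤B (letterIndicator-nonNeg w) (letterIndicator-idem w)
        (subst (λ n → DifferenceBasis n (letterIndicator w)) |w|≡ (unbordered-differenceBasis unbordered)))
    where
    square : ∑ (suc N) (letterIndicator w) * ∑ (suc N) (letterIndicator w) ≡ + (letters w ℕ.* letters w)
    square = trans (cong (λ s → s * s) (trans (cong (λ n → ∑ n (letterIndicator w)) (sym |w|≡)) (∑-letterIndicator w)))
                   (sym (ℤ.pos-* (letters w) (letters w)))

module Profiles where
  open Sums using (Periodic)
  open import Data.Nat using (ℕ; zero; suc)
  open import Data.Nat.DivMod using (_%_; [m+n]%n≡m%n)
  open import Data.Integer using (ℤ)
  open import Data.Integer.Literals using (number; negative)
  open import Agda.Builtin.FromNat using (fromNat)
  open import Agda.Builtin.FromNeg using (fromNeg)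
  open import Data.Unit using (tt)
  open import Data.List using (List; []; _∷_)
  open import Data.List.NonEmpty using (List⁺; _∷_; length; toList)
  open import Relation.Binary.PropositionalEquality using (cong)

  instance
    _ = number
    _ = negative
    _ = tt

  Profile : Set
  Profile = List⁺ ℤ

  -- The default 0 is never reached: cycle only looks up indices below the length.
  nth : List ℤ → ℕ → ℤ
  nth [] _ = 0
  nth (x ∷ _) zero = x
  nth (_ ∷ xs) (suc i) = nth xs i

  cycle : Profile → ℕ → ℤ
  cycle p i = nth (toList p) (i % length p)

  cycle-periodic : ∀ p → Periodic (length p) (cycle p)
  cycle-periodic p i = cong (nth (toList p)) ([m+n]%n≡m%n i (length p))

  -- Any profile gives a valid bound; these are tuned to reach the constant 2.43.
  wave₂₄ wave₈ wave₆ wave₃ : Profile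
  wave₂₄ = 10 ∷ 10 ∷ 9 ∷ 7 ∷ 5 ∷ 3 ∷ 0 ∷ -3 ∷ -5 ∷ -7 ∷ -9 ∷ -10
         ∷ -10 ∷ -10 ∷ -9 ∷ -7 ∷ -5 ∷ -3 ∷ 0 ∷ 3 ∷ 5 ∷ 7 ∷ 9 ∷ 10 ∷ []
  wave₈  = 3 ∷ 2 ∷ 0 ∷ -2 ∷ -3 ∷ -2 ∷ 0 ∷ 2 ∷ []
  wave₆  = 5 ∷ 3 ∷ -2 ∷ -5 ∷ -3 ∷ 3 ∷ []
  wave₃  = 2 ∷ -1 ∷ -1 ∷ []

module SmallLengths where
  open Correlation using (autocorr; autocorr₀-nonNeg; *-nonNeg)
  open Stair using (stairBound)
  open Letters using (letters; unbordered-stair-bound)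
  open Profiles
  open import Data.Nat as ℕ using (ℕ; zero; suc; _/_; _%_; _∸_; _<ᵇ_)
  import Data.Nat.Properties as ℕ
  import Data.Nat.DivMod as ℕ
  open import Data.Bool using (if_then_else_)
  open import Data.Fin using (Fin; toℕ; fromℕ<)
  open import Data.Fin.Properties using (all?; toℕ-fromℕ<)
  open import Data.Integer using (ℤ; +_; 0ℤ; _*_; _≤_; _<_; +≤+; nonNegative)
  import Data.Integer.Properties as ℤ
  open import Data.List.NonEmpty using (length)
  import Data.List as List
  open import Data.List using (List; []; _∷_; findᵇ)
  open import Data.Maybe using (maybe′)
  open import Function using (_∘_)
  open import Data.Product using (_×_; _,_; proj₁; proj₂)
  open import Data.Empty using (⊥)
  open import Relation.Nullary.Decidable using (Dec; no; _×-dec_; from-yes)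
  open import Relation.Binary.PropositionalEquality

  rootBelow : ℕ → ℕ → ℕ
  rootBelow zero    n = 0
  rootBelow (suc j) n = if 100 ℕ.* (suc j ℕ.* suc j) <ᵇ 243 ℕ.* (n ∸ 1) then suc j else rootBelow j n

  -- rootBelow only proposes j: the first component forces ℓ > j, the second checks that this suffices.
  Certifies : Profile → ℕ → ℕ → Set
  Certifies p zero    n = ⊥
  Certifies p (suc b) n =
    + (j ℕ.* j) * (+ B * autocorr (length p) (cycle p) 0) < stairBound (length p) (cycle p) B (n / B) (n % B)
    × 243 ℕ.* (n ∸ 1) ℕ.≤ 100 ℕ.* (suc j ℕ.* suc j)
    where
    B = suc b
    j = rootBelow n n

  certifies? : ∀ p B n → Dec (Certifies p B n)
  certifies? p zero    n = no λ ()
  certifies? p (suc b) n = (_ ℤ.<? _) ×-dec (_ ℕ.≤? _)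

  -- wave₂₄ with block length ⌊(n + 9)/17⌋ certifies every length 2 ≤ n ≤ 391 except these.
  exceptionalLengths : List (ℕ × Profile × ℕ)
  exceptionalLengths =
    (2 , wave₆ , 1) ∷ (3 , wave₃ , 1) ∷ (4 , wave₆ , 1) ∷ (5 , wave₆ , 1) ∷ (6 , wave₆ , 1) ∷ (7 , wave₆ , 1)
    ∷ (8 , wave₆ , 2) ∷ (9 , wave₆ , 2) ∷ (10 , wave₆ , 1) ∷ (12 , wave₆ , 3) ∷ (22 , wave₆ , 5) ∷ (23 , wave₆ , 5)
    ∷ (24 , wave₆ , 5) ∷ (28 , wave₆ , 6) ∷ (43 , wave₆ , 9) ∷ (61 , wave₆ , 14) ∷ (94 , wave₈ , 16) ∷ []

  certificate : ℕ → Profile × ℕ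
  certificate n = maybe′ proj₂ (wave₂₄ , (n ℕ.+ 9) / 17) (findᵇ ((ℕ._≡ᵇ n) ∘ proj₁) exceptionalLengths)

  Certified : ℕ → Set
  Certified n = Certifies (proj₁ (certificate n)) (proj₂ (certificate n)) n

  certified? : ∀ n → Dec (Certified n)
  certified? n = certifies? (proj₁ (certificate n)) (proj₂ (certificate n)) n

  all-certified : ∀ (i : Fin 390) → Certified (2 ℕ.+ toℕ i)
  all-certified = from-yes (all? {390} {P = λ i → Certified (2 ℕ.+ toℕ i)} (λ i → certified? (2 ℕ.+ toℕ i)))

  square-cancel-< : ∀ {j ℓ} → j ℕ.* j ℕ.< ℓ ℕ.* ℓ → j ℕ.< ℓ
  square-cancel-< j²<ℓ² = ℕ.≰⇒> (λ ℓ≤j → ℕ.<⇒≱ j²<ℓ² (ℕ.*-mono-≤ ℓ≤j ℓ≤j))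

  certifies-bound : ∀ p B N → Certifies p B (suc N) → ∀ {k} {w : PartialWord k} → Unbordered w → List.length w ≡ suc N →
    243 ℕ.* N ℕ.≤ 100 ℕ.* (letters w ℕ.* letters w)
  certifies-bound p (suc b) N (below-stairBound , target) {w = w} unbordered |w|≡ =
    ℕ.≤-trans target (ℕ.*-monoʳ-≤ 100 (ℕ.*-mono-≤ j<ℓ j<ℓ))
    where
    n = suc N
    B = suc b
    j = rootBelow n n
    c₀ = + B * autocorr (length p) (cycle p) 0
    c₀-nonNeg : 0ℤ ≤ c₀
    c₀-nonNeg = *-nonNeg {+ B} {autocorr (length p) (cycle p) 0} (+≤+ ℕ.z≤n) (autocorr₀-nonNeg (length p) (cycle p))
    division : n / B ℕ.* B ℕ.+ n % B ≡ n
    division = trans (ℕ.+-comm (n / B ℕ.* B) (n % B)) (sym (ℕ.m≡m%n+[m/n]*n n B))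
    stairBound-≤ : stairBound (length p) (cycle p) B (n / B) (n % B) ≤ + (letters w ℕ.* letters w) * c₀
    stairBound-≤ = unbordered-stair-bound (length p) (cycle p) (cycle-periodic p) B unbordered N (n / B) |w|≡
      division (ℕ.<⇒≤ (ℕ.m%n<n n B))
    j<ℓ : j ℕ.< letters w
    j<ℓ = square-cancel-< (ℤ.drop‿+<+
      (ℤ.*-cancelʳ-<-nonNeg c₀ {{nonNegative c₀-nonNeg}} (ℤ.<-≤-trans below-stairBound stairBound-≤)))

  small-bound : ∀ {k} {w : PartialWord k} → Unbordered w → ∀ M → List.length w ≡ 2 ℕ.+ M → M ℕ.< 390 →
    243 ℕ.* suc M ℕ.≤ 100 ℕ.* (letters w ℕ.* letters w)
  small-bound unbordered M |w|≡ M<390 =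
    certifies-bound (proj₁ (certificate (2 ℕ.+ M))) (proj₂ (certificate (2 ℕ.+ M))) (suc M) certified unbordered |w|≡
    where
    certified : Certified (2 ℕ.+ M)
    certified = subst (λ i → Certified (2 ℕ.+ i)) (toℕ-fromℕ< M<390) (all-certified (fromℕ< M<390))

module LargeLengths where
  open Sums using (∑)
  open Correlation using (autocorr)
  open Stair using (stairBound; ramp; ∑-ramp)
  open Letters using (letters; unbordered-stair-bound)
  open Profiles
  open import Data.Nat as ℕ using (ℕ; suc; NonZero; _/_; _%_)
  import Data.Nat.Properties as ℕ
  import Data.Nat.DivMod as ℕ
  import Data.Nat.Tactic.RingSolver as ℕ-Solver
  open import Data.Integer using (ℤ; +_; -_; 0ℤ; 1ℤ; _+_; _-_; _*_; _≤_; _<_; +≤+; +<+; nonNegative; positive)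
  import Data.Integer.Properties as ℤ
  open import Data.Integer.Tactic.RingSolver using (solve-∀)
  open import Data.List.NonEmpty using (length)
  import Data.List as List
  open import Function using (_∘_)
  open import Relation.Binary.PropositionalEquality

  excess : ℤ → ℤ → ℤ
  excess b r = + 2664 * b * b + + 158000 * b + + 10792 * r * b - + 32400 * r * (r + 1ℤ)

  wave₂₄-stairBound : ∀ B .{{_ : NonZero B}} r →
    + 100 * stairBound (length wave₂₄) (cycle wave₂₄) B 17 (suc r) ≡ + 243 * (+ 17 * + B + + r) * (+ B * + 1256) + excess (+ B) (+ r)
  wave₂₄-stairBound B r = trans (cong (+ 100 *_) evaluated) (expand (+ B) (+ r))
    where
    open ≡-Reasoning
    C = autocorr (length wave₂₄) (cycle wave₂₄)
    formula : ℤ → ℤ → ℤ → ℤ → ℤ → ℤ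
    formula c₀ x y u v = + 2 * (+ 17 * + B + (1ℤ + + r)) * (+ B * c₀) - (ramp (+ B) x y (+ B) + ramp (+ B) u v (1ℤ + + r))
    length-cast : + (17 ℕ.* B ℕ.+ suc r) ≡ + 17 * + B + (1ℤ + + r)
    length-cast = trans (ℤ.pos-+ (17 ℕ.* B) (suc r)) (cong (_+ + suc r) (ℤ.pos-* 17 B))
    C₀ : C 0 ≡ + 1256
    C₀ = refl
    ∑C : ∑ 17 C ≡ - + 3814
    ∑C = refl
    ∑C′ : ∑ 17 (C ∘ suc) ≡ - + 5394
    ∑C′ = refl
    C₁₇ : C 17 ≡ - + 324
    C₁₇ = refl
    C₁₈ : C 18 ≡ 0ℤ
    C₁₈ = refl
    values : formula (C 0) (∑ 17 C) (∑ 17 (C ∘ suc)) (C 17) (C 18) ≡ formula (+ 1256) (- + 3814) (- + 5394) (- + 324) 0ℤ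
    values rewrite C₀ | ∑C | ∑C′ | C₁₇ | C₁₈ = refl
    evaluated : stairBound (length wave₂₄) (cycle wave₂₄) B 17 (suc r) ≡ formula (+ 1256) (- + 3814) (- + 5394) (- + 324) 0ℤ
    evaluated = begin
      stairBound (length wave₂₄) (cycle wave₂₄) B 17 (suc r)
        ≡⟨ cong₂ (λ n z → + 2 * n * (+ B * C 0) - (z + ramp (+ B) (C 17) (C 18) (+ suc r)))
             length-cast (∑-ramp 17 (+ B) C (C ∘ suc) (+ B)) ⟩
      formula (C 0) (∑ 17 C) (∑ 17 (C ∘ suc)) (C 17) (C 18)
        ≡⟨ values ⟩
      formula (+ 1256) (- + 3814) (- + 5394) (- + 324) 0ℤ ∎
    expand : ∀ b r →
      + 100 * (+ 2 * (+ 17 * b + (1ℤ + r)) * (b * + 1256) - (ramp b (- + 3814) (- + 5394) b + ramp b (- + 324) 0ℤ (1ℤ + r)))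
      ≡ + 243 * (+ 17 * b + r) * (b * + 1256) + excess b r
    expand = polynomial
      where
      polynomial : ∀ b r →
        + 100 * (+ 2 * (+ 17 * b + (1ℤ + r)) * (b * + 1256)
                 - ((+ 2 * (b * b) * - + 3814 - b * (b - 1ℤ) * - + 3814 + b * (b - 1ℤ) * - + 5394)
                    + (+ 2 * ((1ℤ + r) * b) * - + 324 - (1ℤ + r) * (1ℤ + r - 1ℤ) * - + 324 + (1ℤ + r) * (1ℤ + r - 1ℤ) * 0ℤ)))
        ≡ + 243 * (+ 17 * b + r) * (b * + 1256)
          + (+ 2664 * b * b + + 158000 * b + + 10792 * r * b - + 32400 * r * (r + 1ℤ))
      polynomial = solve-∀

  excess-nonNeg : ∀ {B r} → 23 ℕ.≤ B → r ℕ.≤ 16 → 0ℤ ≤ excess (+ B) (+ r)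
  excess-nonNeg {B} {r} 23≤B r≤16 = ℤ.i≤j⇒0≤j-i (subst₂ _≤_ Q-cast P-cast (+≤+ Q≤P))
    where
    Q≤P : 32400 ℕ.* r ℕ.* (r ℕ.+ 1) ℕ.≤ 2664 ℕ.* B ℕ.* B ℕ.+ 158000 ℕ.* B ℕ.+ 10792 ℕ.* r ℕ.* B
    Q≤P = begin
      32400 ℕ.* r ℕ.* (r ℕ.+ 1)                              ≤⟨ ℕ.*-monoʳ-≤ (32400 ℕ.* r) (ℕ.+-monoˡ-≤ 1 r≤16) ⟩
      32400 ℕ.* r ℕ.* 17                                     ≡⟨ split r ⟩
      10792 ℕ.* r ℕ.* 23 ℕ.+ 302584 ℕ.* r                    ≤⟨ ℕ.+-mono-≤ (ℕ.*-monoʳ-≤ (10792 ℕ.* r) 23≤B) (ℕ.*-monoʳ-≤ 302584 r≤16) ⟩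
      10792 ℕ.* r ℕ.* B ℕ.+ 302584 ℕ.* 16                    ≤⟨ ℕ.+-monoʳ-≤ (10792 ℕ.* r ℕ.* B) (ℕ.m≤m+n 4841344 201912) ⟩
      10792 ℕ.* r ℕ.* B ℕ.+ (2664 ℕ.* 23 ℕ.* 23 ℕ.+ 158000 ℕ.* 23)
        ≤⟨ ℕ.+-monoʳ-≤ (10792 ℕ.* r ℕ.* B)
             (ℕ.+-mono-≤ (ℕ.*-mono-≤ (ℕ.*-monoʳ-≤ 2664 23≤B) 23≤B) (ℕ.*-monoʳ-≤ 158000 23≤B)) ⟩
      10792 ℕ.* r ℕ.* B ℕ.+ (2664 ℕ.* B ℕ.* B ℕ.+ 158000 ℕ.* B) ≡⟨ ℕ.+-comm (10792 ℕ.* r ℕ.* B) _ ⟩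
      2664 ℕ.* B ℕ.* B ℕ.+ 158000 ℕ.* B ℕ.+ 10792 ℕ.* r ℕ.* B ∎
      where
      open ℕ.≤-Reasoning
      split : ∀ r → 32400 ℕ.* r ℕ.* 17 ≡ 10792 ℕ.* r ℕ.* 23 ℕ.+ 302584 ℕ.* r
      split = ℕ-Solver.solve-∀
    Q-cast : + (32400 ℕ.* r ℕ.* (r ℕ.+ 1)) ≡ + 32400 * + r * (+ r + 1ℤ)
    Q-cast = trans (ℤ.pos-* (32400 ℕ.* r) (r ℕ.+ 1)) (cong₂ _*_ (ℤ.pos-* 32400 r) (ℤ.pos-+ r 1))
    P-cast : + (2664 ℕ.* B ℕ.* B ℕ.+ 158000 ℕ.* B ℕ.+ 10792 ℕ.* r ℕ.* B) ≡ + 2664 * + B * + B + + 158000 * + B + + 10792 * + r * + B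
    P-cast = trans (ℤ.pos-+ _ (10792 ℕ.* r ℕ.* B)) (cong₂ _+_
      (trans (ℤ.pos-+ (2664 ℕ.* B ℕ.* B) _)
        (cong₂ _+_ (trans (ℤ.pos-* (2664 ℕ.* B) B) (cong (_* + B) (ℤ.pos-* 2664 B))) (ℤ.pos-* 158000 B)))
      (trans (ℤ.pos-* (10792 ℕ.* r) B) (cong (_* + B) (ℤ.pos-* 10792 r))))

  wave₂₄-bound : ∀ {k} {w : PartialWord k} → Unbordered w → ∀ B .{{_ : NonZero B}} r → 23 ℕ.≤ B → r ℕ.≤ 16 →
    List.length w ≡ suc (17 ℕ.* B ℕ.+ r) → 243 ℕ.* (17 ℕ.* B ℕ.+ r) ℕ.≤ 100 ℕ.* (letters w ℕ.* letters w)
  wave₂₄-bound {w = w} unbordered B {{B≢0}} r 23≤B r≤16 |w|≡ =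
    ℤ.drop‿+≤+ (subst₂ _≤_ (sym (ℤ.pos-* 243 N)) (sym (ℤ.pos-* 100 ℓ²)) cancelled)
    where
    open ℤ.≤-Reasoning
    N = 17 ℕ.* B ℕ.+ r
    ℓ² = letters w ℕ.* letters w
    c₀-pos : 0ℤ < + B * + 1256
    c₀-pos = subst (0ℤ <_) (ℤ.pos-* B 1256)
      (+<+ (ℕ.≤-trans (ℕ.s≤s ℕ.z≤n) (ℕ.*-monoˡ-≤ 1256 (ℕ.<-≤-trans (ℕ.s≤s ℕ.z≤n) 23≤B))))
    stairBound-≤ : stairBound (length wave₂₄) (cycle wave₂₄) B {{B≢0}} 17 (suc r) ≤ + ℓ² * (+ B * + 1256)
    stairBound-≤ = unbordered-stair-bound (length wave₂₄) (cycle wave₂₄) (cycle-periodic wave₂₄) B {{B≢0}} unbordered N 17 |w|≡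
      (ℕ.+-suc (17 ℕ.* B) r)
      (ℕ.≤-trans (ℕ.s≤s r≤16) (ℕ.≤-trans (ℕ.m≤m+n 17 6) 23≤B))
    N-cast : + N ≡ + 17 * + B + + r
    N-cast = trans (ℤ.pos-+ (17 ℕ.* B) r) (cong (_+ + r) (ℤ.pos-* 17 B))
    scaled : + 243 * + N * (+ B * + 1256) ≤ + 100 * + ℓ² * (+ B * + 1256)
    scaled = begin
      + 243 * + N * (+ B * + 1256)
        ≡⟨ cong (λ n → + 243 * n * (+ B * + 1256)) N-cast ⟩
      + 243 * (+ 17 * + B + + r) * (+ B * + 1256)
        ≤⟨ ℤ.i≤i+j (+ 243 * (+ 17 * + B + + r) * (+ B * + 1256)) (excess (+ B) (+ r)) {{nonNegative (excess-nonNeg 23≤B r≤16)}} ⟩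
      + 243 * (+ 17 * + B + + r) * (+ B * + 1256) + excess (+ B) (+ r)
        ≡⟨ sym (wave₂₄-stairBound B {{B≢0}} r) ⟩
      + 100 * stairBound (length wave₂₄) (cycle wave₂₄) B {{B≢0}} 17 (suc r)
        ≤⟨ ℤ.*-monoˡ-≤-nonNeg (+ 100) stairBound-≤ ⟩
      + 100 * (+ ℓ² * (+ B * + 1256))
        ≡⟨ sym (ℤ.*-assoc (+ 100) (+ ℓ²) (+ B * + 1256)) ⟩
      + 100 * + ℓ² * (+ B * + 1256) ∎
    cancelled : + 243 * + N ≤ + 100 * + ℓ²
    cancelled = ℤ.*-cancelʳ-≤-pos (+ 243 * + N) (+ 100 * + ℓ²) (+ B * + 1256) {{positive c₀-pos}} scaled

  large-bound : ∀ {k} {w : PartialWord k} → Unbordered w → ∀ N → List.length w ≡ suc N → 391 ℕ.≤ N →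
    243 ℕ.* N ℕ.≤ 100 ℕ.* (letters w ℕ.* letters w)
  large-bound {w = w} unbordered N |w|≡ 391≤N =
    subst (λ n → 243 ℕ.* n ℕ.≤ 100 ℕ.* (letters w ℕ.* letters w)) N≡
      (wave₂₄-bound unbordered (N / 17) {{B≢0}} (N % 17) 23≤B (ℕ.≤-pred (ℕ.m%n<n N 17)) (trans |w|≡ (cong suc (sym N≡))))
    where
    23≤B : 23 ℕ.≤ N / 17
    23≤B = ℕ./-monoˡ-≤ 17 391≤N
    B≢0 : NonZero (N / 17)
    B≢0 = ℕ.>-nonZero (ℕ.<-≤-trans (ℕ.s≤s ℕ.z≤n) 23≤B)
    N≡ : 17 ℕ.* (N / 17) ℕ.+ N % 17 ≡ N
    N≡ = trans (cong (ℕ._+ N % 17) (ℕ.*-comm 17 (N / 17))) (trans (ℕ.+-comm (N / 17 ℕ.* 17) (N % 17)) (sym (ℕ.m≡m%n+[m/n]*n N 17)))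

open Letters using (letters)
open SmallLengths using (small-bound)
open LargeLengths using (large-bound)
open import Data.Nat using (ℕ; zero; suc; _≤_; _<?_; _∸_; _*_; _^_; z≤n; s≤s)
open import Data.Nat.Properties using (*-identityʳ; ≮⇒≥)
open import Data.List using (length)
open import Relation.Nullary using (yes; no)
open import Relation.Binary.PropositionalEquality using (_≡_; cong; sym; subst)

letters-bound : ∀ {k} {w : PartialWord k} → Unbordered w → ∀ N → length w ≡ suc N → 243 * N ≤ 100 * (letters w * letters w)
letters-bound unbordered zero    |w|≡ = z≤n
letters-bound unbordered (suc M) |w|≡ with M <? 390
... | yes M<390 = small-bound unbordered M |w|≡ M<390
... | no  M≮390 = large-bound unbordered (suc M) |w|≡ (s≤s (≮⇒≥ M≮390))

theorem4 : (k n : ℕ) → 2 ≤ k → 1 ≤ n →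
    (w : PartialWord k) → length w ≡ n → Unbordered w →
    243 * (n ∸ 1) ≤ 100 * (n ∸ holes w) ^ 2
theorem4 k zero    _ () w |w|≡ unbordered
theorem4 k (suc N) _ _  w |w|≡ unbordered =
  subst (λ n → 243 * N ≤ 100 * (n ∸ holes w) ^ 2) |w|≡
    (subst (λ s → 243 * N ≤ 100 * s) (sym square) (letters-bound unbordered N |w|≡))
  where
  square : letters w ^ 2 ≡ letters w * letters w
  square = cong (letters w *_) (*-identityʳ (letters w))
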